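{- For all graphs $G$ and $G'$, $\operatorname{ft}(G)\cdot\operatorname{ft}(G')\le \operatorname{ft}(G\Box G')$.
   Context: All graphs are finite, simple and undirected with nonempty vertex sets. A fort of $G$ is a nonempty set $F\subseteq V(G)$ such that every $v\in V(G)\setminus F$ satisfies $|N_G(v)\cap F|\neq 1$. The fort number $\operatorname{ft}(G)$ is the maximum number of forts in a collection of pairwise disjoint forts of $G$. The Cartesian product $G\Box G'$ has vertex set $V(G)\times V(G')$, with $(u,u')\sim(v,v')$ iff ($u=v$ and $u'v'\in E(G')$) or ($u'=v'$ and $uv\in E(G)$). -}

module Defs where

open import Data.Nat using (ℕ; suc; _+_; _*_; _≤_)
open import Data.Bool using (Bool; true; false; _∧_; _∨_; if_then_else_)
open import Data.Fin using (Fin)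
open import Data.Fin.Properties using (_≟_)
open import Data.Product using (Σ; ∃; _×_; _,_)
import Relation.Nullary
import Data.Empty
open import Relation.Binary.PropositionalEquality using (_≡_; _≢_)
open import Relation.Nullary.Decidable using (⌊_⌋)
open import Data.Vec.Functional using (Vector)

-- A finite simple undirected graph on the vertex set Fin n (n ≥ 1, given as suc n).
-- Adjacency is Bool-valued (hence decidable), symmetric and irreflexive.
record Graph : Set where
  field
    n       : ℕ
    adj     : Fin (suc n) → Fin (suc n) → Bool
    sym     : ∀ u v → adj u v ≡ adj v u
    irrefl  : ∀ v → adj v v ≡ false

open Graph public

V : Graph → Set
V G = Fin (suc (n G))

count : {m : ℕ} → (Fin m → Bool) → ℕ
count {ℕ.zero} p = 0
count {suc m} p = (if p Fin.zero then 1 else 0) + count (λ i → p (Fin.suc i))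

VSet : Graph → Set
VSet G = V G → Bool

nbrsIn : (G : Graph) → VSet G → V G → ℕ
nbrsIn G F v = count (λ w → adj G v w ∧ F w)

IsFort : (G : Graph) → VSet G → Set
IsFort G F = (∃ λ v → F v ≡ true) × (∀ v → F v ≡ false → nbrsIn G F v ≢ 1)

HasDisjointForts : Graph → ℕ → Set
HasDisjointForts G k =
  Σ (Fin k → VSet G) λ 𝓕 →
    (∀ i → IsFort G (𝓕 i)) ×
    (∀ i j → i ≢ j → ∀ v → 𝓕 i v ≡ true → 𝓕 j v ≡ false)

IsFortNumber : Graph → ℕ → Set
IsFortNumber G m = HasDisjointForts G m × (∀ k → HasDisjointForts G k → k ≤ m)

-- Vertex set V(G) × V(G') is encoded as
-- Fin (|V(G)| * |V(G')|) via Data.Fin.combine / remQuot ((u,u') ↦ u * |V(G')| + u').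
-- Note suc a * suc b reduces to suc (b + a * suc b).
open import Data.Fin using (combine; remQuot)
open import Data.Bool.Properties using (∧-zeroʳ)
open import Relation.Nullary.Decidable using (dec-true; dec-false)
open import Relation.Binary.PropositionalEquality using (refl; cong; cong₂; trans)

private
  ⌊≟⌋-sym : ∀ {m} (a b : Fin m) → ⌊ a ≟ b ⌋ ≡ ⌊ b ≟ a ⌋
  ⌊≟⌋-sym a b with a ≟ b | b ≟ a
  ... | Relation.Nullary.yes _ | Relation.Nullary.yes _ = refl
  ... | Relation.Nullary.no _ | Relation.Nullary.no _ = refl
  ... | Relation.Nullary.yes p | Relation.Nullary.no q = Data.Empty.⊥-elim (q (Relation.Binary.PropositionalEquality.sym p))
  ... | Relation.Nullary.no p | Relation.Nullary.yes q = Data.Empty.⊥-elim (p (Relation.Binary.PropositionalEquality.sym q))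

□adjP : (G G' : Graph) → V G × V G' → V G × V G' → Bool
□adjP G G' (u , u') (v , v') =
  (⌊ u ≟ v ⌋ ∧ adj G' u' v') ∨ (⌊ u' ≟ v' ⌋ ∧ adj G u v)

private
  □sym : (G G' : Graph) → ∀ p q → □adjP G G' p q ≡ □adjP G G' q p
  □sym G G' (u , u') (v , v') =
    cong₂ _∨_ (cong₂ _∧_ (⌊≟⌋-sym u v) (Graph.sym G' u' v'))
              (cong₂ _∧_ (⌊≟⌋-sym u' v') (Graph.sym G u v))
  □irr : (G G' : Graph) → ∀ p → □adjP G G' p p ≡ false
  □irr G G' (u , u') rewrite irrefl G u | irrefl G' u'
    | ∧-zeroʳ ⌊ u ≟ u ⌋ | ∧-zeroʳ ⌊ u' ≟ u' ⌋ = refl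

_□_ : Graph → Graph → Graph
G □ G' = record
  { n = n G' + n G * suc (n G')
  ; adj = λ x y → □adjP G G' (remQuot (suc (n G')) x) (remQuot (suc (n G')) y)
  ; sym = λ x y → □sym G G' (remQuot (suc (n G')) x) (remQuot (suc (n G')) y)
  ; irrefl = λ x → □irr G G' (remQuot (suc (n G')) x)
  }

-- If F and F' are forts of G and G', then F × F' is a fort of G □ G': a vertex (v, v') outside
-- F × F' has [v ∈ F]·|N'(v') ∩ F'| + |N(v) ∩ F|·[v' ∈ F'] neighbours in F × F'. At most one
-- indicator is 1, so this is 0 or a neighbour count that the fort property of F or F' keeps
-- away from 1. Hence the pairwise products of m disjoint forts of G and m' disjoint forts of G'
-- are m·m' disjoint forts of G □ G'.
module Submission where

open import Defs hiding (sym)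
open import Data.Nat using (ℕ; zero; suc; _+_; _*_; _≤_)
open import Data.Nat.Properties using (+-assoc; +-identityʳ; +-suc; *-identityˡ; *-identityʳ; *-zeroʳ; *-distribʳ-+)
open import Data.Bool using (Bool; true; false; _∧_; _∨_; if_then_else_)
open import Data.Bool.Properties using (∧-zeroʳ)
open import Data.Bool.Solver using (module ∨-∧-Solver)
open import Data.Fin using (Fin; _↑ˡ_; _↑ʳ_; combine; remQuot)
open import Data.Fin.Properties using (_≟_; splitAt-↑ʳ; remQuot-combine; *↔×)
open import Data.Product using (_×_; _,_; proj₁; proj₂)
open import Relation.Nullary using (yes; no; contradiction)
open import Relation.Nullary.Decidable using (⌊_⌋)
open import Function using (_∘_; Injection)
open import Function.Properties.Inverse using (↔⇒↣)
open import Relation.Binary.PropositionalEquality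
open ≡-Reasoning

toℕ : Bool → ℕ
toℕ b = if b then 1 else 0

Disjoint : {A : Set} → (A → Bool) → (A → Bool) → Set
Disjoint p q = ∀ a → p a ≡ true → q a ≡ false

_⊗_ : {A B : Set} → (A → Bool) → (B → Bool) → A × B → Bool
(p ⊗ q) (a , b) = p a ∧ q b

⊗-disjointˡ : ∀ {A B : Set} {p q : A → Bool} (p' q' : B → Bool) → Disjoint p q → Disjoint (p ⊗ p') (q ⊗ q')
⊗-disjointˡ {p = p} p' q' disj (a , b) h with p a in pa
... | true = cong (_∧ q' b) (disj a pa)
⊗-disjointˡ p' q' disj (a , b) () | false

⊗-disjointʳ : ∀ {A B : Set} (p q : A → Bool) {p' q' : B → Bool} → Disjoint p' q' → Disjoint (p ⊗ p') (q ⊗ q')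
⊗-disjointʳ p q disj (a , b) h with p a
... | true = trans (cong (q a ∧_) (disj b h)) (∧-zeroʳ (q a))
⊗-disjointʳ p q disj (a , b) () | false

count-cong : ∀ {a} {p q : Fin a → Bool} → (∀ i → p i ≡ q i) → count p ≡ count q
count-cong {zero} eq = refl
count-cong {suc a} eq = cong₂ _+_ (cong toℕ (eq Fin.zero)) (count-cong (λ i → eq (Fin.suc i)))

count-false : ∀ a → count {a} (λ _ → false) ≡ 0
count-false zero = refl
count-false (suc a) = count-false a

count-∧ˡ : ∀ {a} b (p : Fin a → Bool) → count (λ i → b ∧ p i) ≡ toℕ b * count p
count-∧ˡ true p = sym (+-identityʳ (count p))
count-∧ˡ {a} false p = count-false a

count-∨ : ∀ {a} (p q : Fin a → Bool) → Disjoint p q → count (λ i → p i ∨ q i) ≡ count p + count q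
count-∨ {zero} p q disj = refl
count-∨ {suc a} p q disj
  with p Fin.zero in p₀ | q Fin.zero in q₀
     | count-∨ (λ i → p (Fin.suc i)) (λ i → q (Fin.suc i)) (λ i → disj (Fin.suc i))
... | true  | true  | _    = contradiction (trans (sym q₀) (disj Fin.zero p₀)) λ ()
... | true  | false | rest = cong suc rest
... | false | false | rest = rest
... | false | true  | rest = trans (cong suc rest) (sym (+-suc _ _))

count-++ : ∀ b c (p : Fin (b + c) → Bool) →
           count p ≡ count (λ i → p (i ↑ˡ c)) + count (λ i → p (b ↑ʳ i))
count-++ zero c p = refl
count-++ (suc b) c p = begin
  toℕ (p Fin.zero) + count (λ i → p (Fin.suc i))
    ≡⟨ cong (toℕ (p Fin.zero) +_) (count-++ b c (λ i → p (Fin.suc i))) ⟩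
  toℕ (p Fin.zero) + (count (λ i → p (Fin.suc (i ↑ˡ c))) + count (λ i → p (Fin.suc (b ↑ʳ i))))
    ≡⟨ sym (+-assoc (toℕ (p Fin.zero)) _ _) ⟩
  toℕ (p Fin.zero) + count (λ i → p (Fin.suc (i ↑ˡ c))) + count (λ i → p (Fin.suc (b ↑ʳ i))) ∎

remQuot-↑ʳ : ∀ a b (y : Fin (a * b)) →
             remQuot {suc a} b (b ↑ʳ y) ≡ (Fin.suc (proj₁ (remQuot {a} b y)) , proj₂ (remQuot {a} b y))
remQuot-↑ʳ a b y rewrite splitAt-↑ʳ b (a * b) y = refl

count-⊗ : ∀ a b (p : Fin a → Bool) (q : Fin b → Bool) →
          count {a * b} (λ y → (p ⊗ q) (remQuot b y)) ≡ count p * count q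
count-⊗ zero b p q = refl
count-⊗ (suc a) b p q = begin
  count (λ y → (p ⊗ q) (remQuot b y))
    ≡⟨ count-++ b (a * b) _ ⟩
  count (λ j → (p ⊗ q) (remQuot b (j ↑ˡ a * b))) + count (λ y → (p ⊗ q) (remQuot b (b ↑ʳ y)))
    ≡⟨ cong₂ _+_ (count-cong (λ j → cong (p ⊗ q) (remQuot-combine {suc a} Fin.zero j)))
                 (count-cong (λ y → cong (p ⊗ q) (remQuot-↑ʳ a b y))) ⟩
  count (λ j → p Fin.zero ∧ q j) + count (λ y → ((λ i → p (Fin.suc i)) ⊗ q) (remQuot b y))
    ≡⟨ cong₂ _+_ (count-∧ˡ (p Fin.zero) q) (count-⊗ a b (λ i → p (Fin.suc i)) q) ⟩
  toℕ (p Fin.zero) * count q + count (λ i → p (Fin.suc i)) * count q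
    ≡⟨ sym (*-distribʳ-+ (count q) (toℕ (p Fin.zero)) _) ⟩
  count p * count q ∎

⌊suc≟suc⌋ : ∀ {a} (v w : Fin a) → ⌊ Fin.suc v ≟ Fin.suc w ⌋ ≡ ⌊ v ≟ w ⌋
⌊suc≟suc⌋ v w with v ≟ w
... | yes _ = refl
... | no _ = refl

count-≟∧ : ∀ {a} (v : Fin a) (p : Fin a → Bool) → count (λ w → ⌊ v ≟ w ⌋ ∧ p w) ≡ toℕ (p v)
count-≟∧ {suc a} Fin.zero p = trans (cong (toℕ (p Fin.zero) +_) (count-false a)) (+-identityʳ _)
count-≟∧ {suc a} (Fin.suc v) p =
  trans (count-cong (λ w → cong (_∧ p (Fin.suc w)) (⌊suc≟suc⌋ v w))) (count-≟∧ v (λ i → p (Fin.suc i)))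

module _ (G G' : Graph) where

  pair : V (G □ G') → V G × V G'
  pair = remQuot (suc (n G'))

  _⊠_ : VSet G → VSet G' → VSet (G □ G')
  (F ⊠ F') x = (F ⊗ F') (pair x)

  □adjP-∧-split : (F : VSet G) (F' : VSet G') (v w : V G) (v' w' : V G') →
    □adjP G G' (v , v') (w , w') ∧ (F w ∧ F' w')
      ≡ ((⌊ v ≟ w ⌋ ∧ F w) ∧ (adj G' v' w' ∧ F' w')) ∨ ((adj G v w ∧ F w) ∧ (⌊ v' ≟ w' ⌋ ∧ F' w'))
  □adjP-∧-split F F' v w v' w' =
    solve 6 (λ e a' e' a f f' → ((e :* a') :+ (e' :* a)) :* (f :* f')
                                  := ((e :* f) :* (a' :* f')) :+ ((a :* f) :* (e' :* f')))
          refl ⌊ v ≟ w ⌋ (adj G' v' w') ⌊ v' ≟ w' ⌋ (adj G v w) (F w) (F' w')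
    where open ∨-∧-Solver

  ≟-adj-disjoint : (F : VSet G) (F' : VSet G') (v : V G) (v' : V G') →
    Disjoint ((λ w → ⌊ v ≟ w ⌋ ∧ F w) ⊗ (λ w' → adj G' v' w' ∧ F' w'))
             ((λ w → adj G v w ∧ F w) ⊗ (λ w' → ⌊ v' ≟ w' ⌋ ∧ F' w'))
  ≟-adj-disjoint F F' v v' (w , w') h with v ≟ w
  ... | yes refl rewrite irrefl G v = refl
  ≟-adj-disjoint F F' v v' (w , w') () | no _

  nbrsIn-⊠ : (F : VSet G) (F' : VSet G') (x : V (G □ G')) →
    let (v , v') = pair x in
    nbrsIn (G □ G') (F ⊠ F') x ≡ toℕ (F v) * nbrsIn G' F' v' + nbrsIn G F v * toℕ (F' v')
  nbrsIn-⊠ F F' x = degree (pair x)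
    where
    degree : ∀ vv → let (v , v') = vv in
      count (λ y → □adjP G G' vv (pair y) ∧ (F ⊗ F') (pair y))
        ≡ toℕ (F v) * nbrsIn G' F' v' + nbrsIn G F v * toℕ (F' v')
    degree (v , v') = begin
      count (λ y → □adjP G G' (v , v') (pair y) ∧ (F ⊗ F') (pair y))
        ≡⟨ count-cong (λ y → □adjP-∧-split F F' v (proj₁ (pair y)) v' (proj₂ (pair y))) ⟩
      count (λ y → (P ⊗ Q') (pair y) ∨ (Q ⊗ P') (pair y))
        ≡⟨ count-∨ _ _ (λ y → ≟-adj-disjoint F F' v v' (pair y)) ⟩
      count (λ y → (P ⊗ Q') (pair y)) + count (λ y → (Q ⊗ P') (pair y))
        ≡⟨ cong₂ _+_ (count-⊗ _ _ P Q') (count-⊗ _ _ Q P') ⟩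
      count P * count Q' + count Q * count P'
        ≡⟨ cong₂ _+_ (cong (_* count Q') (count-≟∧ v F)) (cong (count Q *_) (count-≟∧ v' F')) ⟩
      toℕ (F v) * nbrsIn G' F' v' + nbrsIn G F v * toℕ (F' v') ∎
      where
      P = λ w → ⌊ v ≟ w ⌋ ∧ F w
      Q = λ w → adj G v w ∧ F w
      P' = λ w' → ⌊ v' ≟ w' ⌋ ∧ F' w'
      Q' = λ w' → adj G' v' w' ∧ F' w'

  ⊠-isFort : ∀ {F F'} → IsFort G F → IsFort G' F' → IsFort (G □ G') (F ⊠ F')
  ⊠-isFort {F} {F'} ((v , v∈F) , fortF) ((v' , v'∈F') , fortF') =
    (combine v v' , nonempty) ,
    λ x x∉ deg≡1 → degree≢1 (pair x) x∉ (trans (sym (nbrsIn-⊠ F F' x)) deg≡1)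
    where
    nonempty : (F ⊠ F') (combine v v') ≡ true
    nonempty = trans (cong (F ⊗ F') (remQuot-combine v v')) (cong₂ _∧_ v∈F v'∈F')

    degree≢1 : ∀ ((w , w') : V G × V G') → F w ∧ F' w' ≡ false →
               toℕ (F w) * nbrsIn G' F' w' + nbrsIn G F w * toℕ (F' w') ≢ 1
    degree≢1 (w , w') _ with F w in w∈F | F' w' in w'∈F'
    degree≢1 (w , w') () | true | true
    ... | true | false = fortF' w' w'∈F' ∘ trans (sym (begin
      1 * nbrsIn G' F' w' + nbrsIn G F w * 0
        ≡⟨ cong₂ _+_ (*-identityˡ (nbrsIn G' F' w')) (*-zeroʳ (nbrsIn G F w)) ⟩
      nbrsIn G' F' w' + 0
        ≡⟨ +-identityʳ _ ⟩
      nbrsIn G' F' w' ∎))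
    ... | false | true = fortF w w∈F ∘ trans (sym (*-identityʳ (nbrsIn G F w)))
    ... | false | false = (λ ()) ∘ trans (sym (*-zeroʳ (nbrsIn G F w)))

⊠-hasDisjointForts : ∀ {G G' m m'} → HasDisjointForts G m → HasDisjointForts G' m' →
                     HasDisjointForts (G □ G') (m * m')
⊠-hasDisjointForts {G} {G'} {m} {m'} (𝓕 , forts , disj) (𝓕' , forts' , disj') =
  𝓟 , (λ k → ⊠-isFort G G' (forts (i k)) (forts' (j k))) , 𝓟-disjoint
  where
  i : Fin (m * m') → Fin m
  i k = proj₁ (remQuot {m} m' k)
  j : Fin (m * m') → Fin m'
  j k = proj₂ (remQuot {m} m' k)

  𝓟 : Fin (m * m') → VSet (G □ G')
  𝓟 k = _⊠_ G G' (𝓕 (i k)) (𝓕' (j k))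

  𝓟-disjoint : ∀ k l → k ≢ l → Disjoint (𝓟 k) (𝓟 l)
  𝓟-disjoint k l k≢l x with i k ≟ i l | j k ≟ j l
  ... | no i≢ | _ = ⊗-disjointˡ (𝓕' (j k)) (𝓕' (j l)) (disj (i k) (i l) i≢) (pair G G' x)
  ... | yes _ | no j≢ = ⊗-disjointʳ (𝓕 (i k)) (𝓕 (i l)) (disj' (j k) (j l) j≢) (pair G G' x)
  ... | yes i≡ | yes j≡ = contradiction (Injection.injective (↔⇒↣ (*↔× {m} {m'})) (cong₂ _,_ i≡ j≡)) k≢l

corollary4p13 : (G G' : Graph) (m m' p : ℕ) → IsFortNumber G m → IsFortNumber G' m' → IsFortNumber (G □ G') p → m * m' ≤ p
corollary4p13 G G' m m' p (forts , _) (forts' , _) (_ , maximal) =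
  maximal (m * m') (⊠-hasDisjointForts {G} {G'} forts forts')
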